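{- For all integers $q_0,d\ge 1$, if $n\ge (d-1)\binom{2q_0+1}{q_0}+1$ and $n\ge d$, then for all integers $q\le q_0$ and $p>2q$ (with $q\ge 1$) there is no dominating $(p:q)$-colouring of $H_{n,d}$.
   Context: For integers $1\le d\le n$, $H_{n,d}$ is the bipartite graph with parts $A=[n]$ and $B=\binom{A}{d}$ (all $d$-subsets of $A$), in which $a\in A$ and $b\in B$ are adjacent if and only if $a\in b$. $N[v]$ denotes the closed neighbourhood of $v$. For integers $0<q\le p$, a dominating $(p:q)$-colouring of a graph $G$ is a map $\phi\colon V(G)\to\binom{[p]}{q}$ such that $\bigcup_{u\in N[v]}\phi(u)=[p]$ for every $v\in V(G)$. -}

module Defs where

open import Data.Nat using (ℕ)
open import Data.Fin using (Fin)
open import Data.Fin.Subset using (Subset; _∈_; ∣_∣)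
open import Data.Sum using (_⊎_; inj₁; inj₂)
open import Data.Product using (Σ; ∃; _×_; _,_; proj₁)
open import Data.Empty using (⊥)
open import Relation.Binary.PropositionalEquality using (_≡_)
open import Level using (0ℓ)

record Graph : Set₁ where
  field
    V   : Set
    Adj : V → V → Set

open Graph public

ClosedNbr : (G : Graph) → V G → V G → Set
ClosedNbr G v u = (u ≡ v) ⊎ Adj G v u

KSubset : ℕ → ℕ → Set
KSubset n d = Σ (Subset n) (λ b → ∣ b ∣ ≡ d)

-- H_{n,d}: parts A = [n] (inj₁) and B = d-subsets of [n] (inj₂), a ~ b iff a ∈ b
HAdj : (n d : ℕ) → Fin n ⊎ KSubset n d → Fin n ⊎ KSubset n d → Set
HAdj n d (inj₁ a) (inj₁ a′) = ⊥
HAdj n d (inj₁ a) (inj₂ (b , _)) = a ∈ b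
HAdj n d (inj₂ (b , _)) (inj₁ a) = a ∈ b
HAdj n d (inj₂ _) (inj₂ _) = ⊥

H : ℕ → ℕ → Graph
H n d = record { V = Fin n ⊎ KSubset n d ; Adj = HAdj n d }

-- dominating (p:q)-colouring: φ : V → ([p] choose q) with
-- ⋃_{u ∈ N[v]} φ(u) = [p] for every v
-- (⊆ direction is automatic; we state ⊇: every colour c is in φ(u) for some u ∈ N[v])
IsDominatingColouring : (G : Graph) (p q : ℕ) → (V G → KSubset p q) → Set
IsDominatingColouring G p q φ =
  (v : V G) (c : Fin p) → ∃ λ u → ClosedNbr G v u × c ∈ proj₁ (φ u)

DominatingColouring : (G : Graph) (p q : ℕ) → Set
DominatingColouring G p q = Σ (V G → KSubset p q) (IsDominatingColouring G p q)

-- Fix a palette T of 2q+1 colours. Every a ∈ A carries q colours, so it meets T in at most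
-- q of them, i.e. inside some q-subset of T; by pigeonhole, once n > (d-1)·C(2q+1,q), some
-- d elements of A all miss a common set of q+1 colours of T. The block b ∈ B formed by these
-- d elements has closed neighbourhood b ∪ {b}, so b itself must carry those q+1 colours,
-- which is impossible with only q. Since C(2q+1,q) grows with q, the bound for q₀ suffices.
module Submission where

open import Defs
open import Data.Nat using (ℕ; _≤_; _<_; _*_; _+_; _∸_)
open import Data.Nat.Combinatorics using (_C_)
open import Relation.Nullary using (¬_)

open import Data.Nat using (zero; suc; s≤s; z<s; _≤′_; ≤′-refl; ≤′-step; _<?_)
open import Data.Nat.Properties
open import Data.Nat.Combinatorics using (nCn≡1; nCk+nC[k+1]≡[n+1]C[k+1])
open import Data.Fin as Fin using (Fin)
open import Data.Fin.Subset
  using (Subset; Side; inside; outside; _∈_; _∉_; _⊆_; ∣_∣; _∩_; ∁; ⊤; ⊥)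
open import Data.Fin.Subset.Properties
  using (∉⊥; ⊥⊆; ∣⊥∣≡0; ∣⊤∣≡n; ∣p∣≤∣x∷p∣; p⊆q⇒∣p∣≤∣q∣; p∩q⊆p; ∣p∩q∣≤∣p∣;
         x∈p∩q⁺; x∈p∩q⁻; x∈∁p⇒x∉p; x∈p⇒∣p-x∣<∣p∣; drop-there; out⊆; in⊆in)
open import Data.Vec using (_∷_; []; head; tail; tabulate; here; there)
open import Data.Vec.Properties using (lookup∘tabulate; []=⇒lookup; lookup⇒[]=)
open import Data.Bool using (_∧_)
open import Data.Sum using (inj₁; inj₂; _⊎_)
open import Data.Product using (∃; _×_; _,_; proj₁; proj₂)
open import Function using (_∘_)
open import Relation.Binary.PropositionalEquality
open import Relation.Nullary using (yes; no; contradiction)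

private variable
  n p : ℕ

nCk≤[1+n]C[1+k] : ∀ n k → n C k ≤ suc n C suc k
nCk≤[1+n]C[1+k] n k = ≤-trans (m≤m+n _ _) (≤-reflexive (nCk+nC[k+1]≡[n+1]C[k+1] n k))

nC[1+k]≤[1+n]C[1+k] : ∀ n k → n C suc k ≤ suc n C suc k
nC[1+k]≤[1+n]C[1+k] n k = ≤-trans (m≤n+m _ _) (≤-reflexive (nCk+nC[k+1]≡[n+1]C[k+1] n k))

[2k+1]Ck≤[2k+3]C[k+1] : ∀ k → (2 * k + 1) C k ≤ (2 * suc k + 1) C suc k
[2k+1]Ck≤[2k+3]C[k+1] k = begin
  (2 * k + 1) C k                     ≤⟨ nCk≤[1+n]C[1+k] (2 * k + 1) k ⟩
  suc (2 * k + 1) C suc k             ≤⟨ nC[1+k]≤[1+n]C[1+k] (suc (2 * k + 1)) k ⟩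
  suc (suc (2 * k + 1)) C suc k       ≡⟨ cong (λ m → (m + 1) C suc k) (sym (*-suc 2 k)) ⟩
  (2 * suc k + 1) C suc k             ∎
  where open ≤-Reasoning

[2k+1]Ck-mono : ∀ {k m} → k ≤′ m → (2 * k + 1) C k ≤ (2 * m + 1) C m
[2k+1]Ck-mono ≤′-refl          = ≤-refl
[2k+1]Ck-mono (≤′-step {m} k≤m) = ≤-trans ([2k+1]Ck-mono k≤m) ([2k+1]Ck≤[2k+3]C[k+1] m)

pigeonhole-+ : ∀ D a b x y → D * (a + b) < x + y → D * a < x ⊎ D * b < y
pigeonhole-+ D a b x y Da+Db<x+y with D * a <? x
... | yes Da<x = inj₁ Da<x
... | no  Da≮x = inj₂ (+-cancelˡ-< (D * a) (D * b) y (begin-strict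
  D * a + D * b ≡⟨ *-distribˡ-+ D a b ⟨
  D * (a + b)   <⟨ Da+Db<x+y ⟩
  x + y         ≤⟨ +-monoˡ-≤ y (≮⇒≥ Da≮x) ⟩
  D * a + y     ∎))
  where open ≤-Reasoning

subsetOfSize : ∀ (S : Subset n) {k} → k ≤ ∣ S ∣ → ∃ λ S′ → S′ ⊆ S × ∣ S′ ∣ ≡ k
subsetOfSize {n} S             {zero}  _         = ⊥ , ⊥⊆ , ∣⊥∣≡0 n
subsetOfSize (outside ∷ S)     {suc k} k≤∣S∣     with subsetOfSize S k≤∣S∣
... | S′ , S′⊆S , ∣S′∣≡k = outside ∷ S′ , out⊆ S′⊆S , ∣S′∣≡k
subsetOfSize (inside ∷ S)      {suc k} (s≤s k≤∣S∣) with subsetOfSize S k≤∣S∣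
... | S′ , S′⊆S , ∣S′∣≡k = inside ∷ S′ , in⊆in S′⊆S , cong suc ∣S′∣≡k

∣p∩q∣+∣p∩∁q∣≡∣p∣ : ∀ (P Q : Subset n) → ∣ P ∩ Q ∣ + ∣ P ∩ ∁ Q ∣ ≡ ∣ P ∣
∣p∩q∣+∣p∩∁q∣≡∣p∣ []            []            = refl
∣p∩q∣+∣p∩∁q∣≡∣p∣ (inside ∷ P)  (inside ∷ Q)  = cong suc (∣p∩q∣+∣p∩∁q∣≡∣p∣ P Q)
∣p∩q∣+∣p∩∁q∣≡∣p∣ (inside ∷ P)  (outside ∷ Q) = trans (+-suc _ _) (cong suc (∣p∩q∣+∣p∩∁q∣≡∣p∣ P Q))
∣p∩q∣+∣p∩∁q∣≡∣p∣ (outside ∷ P) (inside ∷ Q)  = ∣p∩q∣+∣p∩∁q∣≡∣p∣ P Q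
∣p∩q∣+∣p∩∁q∣≡∣p∣ (outside ∷ P) (outside ∷ Q) = ∣p∩q∣+∣p∩∁q∣≡∣p∣ P Q

∣tail∩tail∣≤∣p∩q∣ : ∀ (P Q : Subset (suc n)) → ∣ tail P ∩ tail Q ∣ ≤ ∣ P ∩ Q ∣
∣tail∩tail∣≤∣p∩q∣ (x ∷ P) (y ∷ Q) = ∣p∣≤∣x∷p∣ (x ∧ y) (P ∩ Q)

zero∈p∩q⇒∣tail∩tail∣<∣p∩q∣ : ∀ {P Q : Subset (suc n)} →
  Fin.zero ∈ P → Fin.zero ∈ Q → ∣ tail P ∩ tail Q ∣ < ∣ P ∩ Q ∣
zero∈p∩q⇒∣tail∩tail∣<∣p∩q∣ here here = ≤-refl

suc∈⇒∈tail : ∀ (P : Subset (suc n)) {x} → Fin.suc x ∈ P → x ∈ tail P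
suc∈⇒∈tail (_ ∷ _) = drop-there

-- t is the size of a palette and r a bound on how many of its colours each X i contains.
record CommonGap {n p} (D : ℕ) (X : Fin n → Subset p) (I : Subset n) (r t : ℕ) : Set where
  field
    members     : Subset n
    gap         : Subset p
    members⊆I   : members ⊆ I
    D<∣members∣ : D < ∣ members ∣
    t≤r+∣gap∣   : t ≤ r + ∣ gap ∣
    avoids      : ∀ {i c} → i ∈ members → c ∈ gap → c ∉ X i

module _ {D r t : ℕ} where

  CommonGap-⊆ : ∀ {X : Fin n → Subset p} {I J} → J ⊆ I → CommonGap D X J r t → CommonGap D X I r t
  CommonGap-⊆ J⊆I g = record
    { members = members ; gap = gap ; members⊆I = J⊆I ∘ members⊆I
    ; D<∣members∣ = D<∣members∣ ; t≤r+∣gap∣ = t≤r+∣gap∣ ; avoids = avoids }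
    where open CommonGap g

  CommonGap-suc : ∀ {X : Fin n → Subset p} {I} → CommonGap D X I r t → CommonGap D X I (suc r) (suc t)
  CommonGap-suc g = record
    { members = members ; gap = gap ; members⊆I = members⊆I
    ; D<∣members∣ = D<∣members∣ ; t≤r+∣gap∣ = s≤s t≤r+∣gap∣ ; avoids = avoids }
    where open CommonGap g

  outside∷gap : ∀ {X : Fin n → Subset (suc p)} {I} → CommonGap D (tail ∘ X) I r t → CommonGap D X I r t
  outside∷gap {X = X} g = record
    { members = members ; gap = outside ∷ gap ; members⊆I = members⊆I
    ; D<∣members∣ = D<∣members∣ ; t≤r+∣gap∣ = t≤r+∣gap∣
    ; avoids = λ { i∈ (there c∈) c∈X → avoids i∈ c∈ (suc∈⇒∈tail (X _) c∈X) } }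
    where open CommonGap g

  inside∷gap : ∀ {X : Fin n → Subset (suc p)} {I} → (∀ {i} → i ∈ I → Fin.zero ∉ X i) →
    CommonGap D (tail ∘ X) I r t → CommonGap D X I r (suc t)
  inside∷gap {X = X} zero∉X g = record
    { members = members ; gap = inside ∷ gap ; members⊆I = members⊆I
    ; D<∣members∣ = D<∣members∣
    ; t≤r+∣gap∣ = ≤-trans (s≤s t≤r+∣gap∣) (≤-reflexive (sym (+-suc r ∣ gap ∣)))
    ; avoids = λ { i∈ here c∈X → zero∉X (members⊆I i∈) c∈X
                 ; i∈ (there c∈) c∈X → avoids i∈ c∈ (suc∈⇒∈tail (X _) c∈X) } }
    where open CommonGap g

∈tabulate⁻ : ∀ (f : Fin n → Side) {i} → i ∈ tabulate f → f i ≡ inside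
∈tabulate⁻ f {i} i∈ = trans (sym (lookup∘tabulate f i)) ([]=⇒lookup i∈)

∈tabulate⁺ : ∀ (f : Fin n → Side) {i} → f i ≡ inside → i ∈ tabulate f
∈tabulate⁺ f {i} fi≡inside = lookup⇒[]= i (tabulate f) (trans (lookup∘tabulate f i) fi≡inside)

zero∈⇒head≡inside : ∀ {P : Subset (suc n)} → Fin.zero ∈ P → head P ≡ inside
zero∈⇒head≡inside here = refl

head≡inside⇒zero∈ : ∀ (P : Subset (suc n)) → head P ≡ inside → Fin.zero ∈ P
head≡inside⇒zero∈ (_ ∷ _) refl = here

holdersOfZero : (Fin n → Subset (suc p)) → Subset n
holdersOfZero X = tabulate (head ∘ X)

∈holdersOfZero⇒zero∈ : ∀ (X : Fin n → Subset (suc p)) {i} → i ∈ holdersOfZero X → Fin.zero ∈ X i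
∈holdersOfZero⇒zero∈ X i∈ = head≡inside⇒zero∈ (X _) (∈tabulate⁻ (head ∘ X) i∈)

∈∁holdersOfZero⇒zero∉ : ∀ (X : Fin n → Subset (suc p)) {i} → i ∈ ∁ (holdersOfZero X) → Fin.zero ∉ X i
∈∁holdersOfZero⇒zero∉ X i∈ zero∈ =
  x∈∁p⇒x∉p i∈ (∈tabulate⁺ (head ∘ X) (zero∈⇒head≡inside zero∈))

-- Pigeonhole over the r-subsets of T containing the traces X i ∩ T, by induction on T with
-- Pascal's rule: split I by whether the first colour of T lies in X i.
commonGap : ∀ D (T : Subset p) (X : Fin n → Subset p) (I : Subset n) r → r ≤ ∣ T ∣ →
  (∀ {i} → i ∈ I → ∣ X i ∩ T ∣ ≤ r) → D * (∣ T ∣ C r) < ∣ I ∣ → CommonGap D X I r ∣ T ∣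
commonGap D T X I zero _ traces≤0 large = record
  { members = I ; gap = T ; members⊆I = λ i∈ → i∈
  ; D<∣members∣ = subst (_< ∣ I ∣) (*-identityʳ D) large ; t≤r+∣gap∣ = ≤-refl
  ; avoids = λ i∈ c∈T c∈X → n≮0 (<-≤-trans (x∈p⇒∣p-x∣<∣p∣ (x∈p∩q⁺ (c∈X , c∈T))) (traces≤0 i∈)) }
commonGap D (outside ∷ T) X I (suc r) r≤∣T∣ traces≤ large =
  outside∷gap (commonGap D T (tail ∘ X) I (suc r) r≤∣T∣
    (λ {i} i∈ → ≤-trans (∣tail∩tail∣≤∣p∩q∣ (X i) _) (traces≤ i∈)) large)
commonGap D (inside ∷ T) X I (suc r) (s≤s r≤∣T∣) traces≤ large with m≤n⇒m<n∨m≡n r≤∣T∣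
... | inj₂ refl = record
  { members = I ; gap = ⊥ ; members⊆I = λ i∈ → i∈
  ; D<∣members∣ = subst (_< ∣ I ∣) (trans (cong (D *_) (nCn≡1 (suc r))) (*-identityʳ D)) large
  ; t≤r+∣gap∣ = m≤m+n _ _ ; avoids = λ _ c∈⊥ → contradiction c∈⊥ ∉⊥ }
... | inj₁ r<∣T∣
    with pigeonhole-+ D (∣ T ∣ C r) (∣ T ∣ C suc r) ∣ I ∩ holdersOfZero X ∣ ∣ I ∩ ∁ (holdersOfZero X) ∣
      (subst₂ _<_ (cong (D *_) (sym (nCk+nC[k+1]≡[n+1]C[k+1] ∣ T ∣ r)))
                  (sym (∣p∩q∣+∣p∩∁q∣≡∣p∣ I (holdersOfZero X))) large)
...   | inj₁ largeHolders = CommonGap-⊆ (p∩q⊆p I _) (CommonGap-suc (outside∷gap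
        (commonGap D T (tail ∘ X) _ r (<⇒≤ r<∣T∣)
          (λ {i} i∈ → let I∈ , H∈ = x∈p∩q⁻ I _ i∈ in
            ≤-pred (<-≤-trans (zero∈p∩q⇒∣tail∩tail∣<∣p∩q∣ (∈holdersOfZero⇒zero∈ X H∈) here)
                              (traces≤ I∈)))
          largeHolders)))
...   | inj₂ largeOthers = CommonGap-⊆ (p∩q⊆p I _) (inside∷gap
        (λ i∈ → ∈∁holdersOfZero⇒zero∉ X (proj₂ (x∈p∩q⁻ I _ i∈)))
        (commonGap D T (tail ∘ X) _ (suc r) r<∣T∣
          (λ {i} i∈ → ≤-trans (∣tail∩tail∣≤∣p∩q∣ (X i) _) (traces≤ (proj₁ (x∈p∩q⁻ I _ i∈))))
          largeOthers))

missedByElements⊆block : ∀ {d q} (φ : V (H n d) → KSubset p q) →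
  IsDominatingColouring (H n d) p q φ → ∀ (b : KSubset n d) {U} →
  (∀ {a c} → a ∈ proj₁ b → c ∈ U → c ∉ proj₁ (φ (inj₁ a))) →
  U ⊆ proj₁ (φ (inj₂ b))
missedByElements⊆block φ dominating b missed {c} c∈U with dominating (inj₂ b) c
... | _      , inj₁ refl , c∈ = c∈
... | inj₁ a , inj₂ a∈b  , c∈ = contradiction c∈ (missed a∈b c∈U)

proposition10 : (q₀ d n : ℕ) → 1 ≤ q₀ → 1 ≤ d →
    (d ∸ 1) * ((2 * q₀ + 1) C q₀) + 1 ≤ n → d ≤ n →
    (q p : ℕ) → 1 ≤ q → q ≤ q₀ → 2 * q < p →
    ¬ DominatingColouring (H n d) p q
proposition10 q₀ (suc D) n _ _ n>bound _ q p _ q≤q₀ 2q<p (φ , dominating) =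
  <-irrefl (cong (q +_) (+-identityʳ q)) (begin-strict
    2 * q         <⟨ m<m+n (2 * q) z<s ⟩
    2 * q + 1     ≡⟨ ∣T∣≡2q+1 ⟨
    ∣ T ∣         ≤⟨ t≤r+∣gap∣ ⟩
    q + ∣ gap ∣   ≤⟨ +-monoʳ-≤ q ∣gap∣≤q ⟩
    q + q         ∎)
  where
  open ≤-Reasoning
  palette : ∃ λ T → T ⊆ ⊤ × ∣ T ∣ ≡ 2 * q + 1
  palette = subsetOfSize ⊤ (subst₂ _≤_ (+-comm 1 (2 * q)) (sym (∣⊤∣≡n p)) 2q<p)
  T : Subset p
  T = proj₁ palette
  ∣T∣≡2q+1 : ∣ T ∣ ≡ 2 * q + 1
  ∣T∣≡2q+1 = proj₂ (proj₂ palette)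
  X : Fin n → Subset p
  X a = proj₁ (φ (inj₁ a))
  D·C<n : D * ((2 * q + 1) C q) < n
  D·C<n = <-≤-trans (s≤s (*-monoʳ-≤ D ([2k+1]Ck-mono (≤⇒≤′ q≤q₀))))
                    (subst (_≤ n) (+-comm _ 1) n>bound)
  g : CommonGap D X ⊤ q ∣ T ∣
  g = commonGap D T X ⊤ q
        (subst (q ≤_) (sym ∣T∣≡2q+1) (≤-trans (m≤m+n q (q + 0)) (m≤m+n _ 1)))
        (λ {i} _ → subst (∣ X i ∩ T ∣ ≤_) (proj₂ (φ (inj₁ i))) (∣p∩q∣≤∣p∣ (X i) T))
        (subst₂ _<_ (cong (λ t → D * (t C q)) (sym ∣T∣≡2q+1)) (sym (∣⊤∣≡n n)) D·C<n)
  open CommonGap g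
  block : ∃ λ S → S ⊆ members × ∣ S ∣ ≡ suc D
  block = subsetOfSize members D<∣members∣
  b : KSubset n (suc D)
  b = proj₁ block , proj₂ (proj₂ block)
  ∣gap∣≤q : ∣ gap ∣ ≤ q
  ∣gap∣≤q = subst (∣ gap ∣ ≤_) (proj₂ (φ (inj₂ b)))
    (p⊆q⇒∣p∣≤∣q∣ (missedByElements⊆block φ dominating b
                    (λ a∈b → avoids (proj₁ (proj₂ block) a∈b))))
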